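{- Let $D$ be a finite source-free digraph and let $S$ be a proper pseudo-source set of $D$. Then $S\cup N^-(S)$ is a strongly connected component of $D$, and it has diameter at most $2|S|$.
   Context: A digraph is source-free if every vertex has in-degree at least $1$. For $S\subseteq V(D)$, $N^-(S)=\{u\in V(D)\setminus S:\exists v\in S,\ uv\in E(D)\}$. A non-empty set $S$ is a pseudo-source set if every $v\in N^-(S)$ satisfies $N^-(\{v\})\subseteq S$; it is proper if no non-empty $T\subsetneq S$ is a pseudo-source set. A set $C$ is strongly connected if for all $u,v\in C$ there is a directed path from $u$ to $v$; a strongly connected component is a maximal strongly connected set. The diameter of a strongly connected set $C$ is $\max_{u,v\in C}\mathrm{dist}_D(u,v)$, where $\mathrm{dist}_D(u,v)$ is the length of a shortest directed path from $u$ to $v$ in $D$. -}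

module Defs where

open import Data.Nat using (ℕ; zero; suc; _≤_; _*_)
open import Data.Bool using (Bool; true; false; T)
open import Data.Fin using (Fin)
open import Data.Fin.Subset using (Subset; _∈_; _∉_; _⊆_; ∣_∣)
open import Data.Product using (Σ; ∃; ∃-syntax; _×_; _,_)
open import Data.Sum using (_⊎_)
open import Relation.Nullary using (¬_)
open import Relation.Binary.PropositionalEquality using (_≡_)

-- A finite digraph on vertex set Fin n: a (decidable) arc relation with no loops
-- (and, being a relation, no multiple arcs).
record Digraph (n : ℕ) : Set where
  field
    adj   : Fin n → Fin n → Bool
    noLoop : ∀ v → adj v v ≡ false

open Digraph public

Arc : ∀ {n} → Digraph n → Fin n → Fin n → Set
Arc D u v = T (adj D u v)

SourceFree : ∀ {n} → Digraph n → Set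
SourceFree {n} D = ∀ (v : Fin n) → ∃[ u ] Arc D u v

-- membership in N^-(S) = { u ∉ S : ∃ v ∈ S, uv ∈ E(D) }
InNeighbour : ∀ {n} → Digraph n → Subset n → Fin n → Set
InNeighbour D S u = u ∉ S × ∃[ v ] (v ∈ S × Arc D u v)

NonEmpty : ∀ {n} → Subset n → Set
NonEmpty S = ∃[ v ] v ∈ S

-- S is a pseudo-source set: nonempty, and every v ∈ N^-(S) has N^-({v}) ⊆ S,
-- i.e. every in-neighbour u ≠ v of v lies in S.
PseudoSource : ∀ {n} → Digraph n → Subset n → Set
PseudoSource D S =
  NonEmpty S ×
  (∀ v → InNeighbour D S v → ∀ u → ¬ (u ≡ v) → Arc D u v → u ∈ S)

ProperPseudoSource : ∀ {n} → Digraph n → Subset n → Set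
ProperPseudoSource D S =
  PseudoSource D S ×
  (∀ T' → NonEmpty T' → T' ⊆ S → ¬ (S ⊆ T') → ¬ PseudoSource D T')

data Walk {n} (D : Digraph n) : Fin n → Fin n → ℕ → Set where
  here : ∀ {v} → Walk D v v zero
  step : ∀ {u w v k} → Arc D u w → Walk D w v k → Walk D u v (suc k)

-- dist_D(u,v) ≤ k  iff there is a directed walk (hence path) from u to v of length ≤ k
DistLe : ∀ {n} → Digraph n → Fin n → Fin n → ℕ → Set
DistLe D u v k = ∃[ l ] (l ≤ k × Walk D u v l)

Reachable : ∀ {n} → Digraph n → Fin n → Fin n → Set
Reachable D u v = ∃[ l ] Walk D u v l

StronglyConnected : ∀ {n} → Digraph n → Subset n → Set
StronglyConnected D C = ∀ u v → u ∈ C → v ∈ C → Reachable D u v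

SCC : ∀ {n} → Digraph n → Subset n → Set
SCC D C =
  StronglyConnected D C ×
  (∀ C' → C ⊆ C' → StronglyConnected D C' → C' ⊆ C)

DiameterLe : ∀ {n} → Digraph n → Subset n → ℕ → Set
DiameterLe D C k = ∀ u v → u ∈ C → v ∈ C → DistLe D u v k

IsClosedNbhd : ∀ {n} → Digraph n → Subset n → Subset n → Set
IsClosedNbhd D S C = ∀ x → (x ∈ C → (x ∈ S ⊎ InNeighbour D S x))
                         × ((x ∈ S ⊎ InNeighbour D S x) → x ∈ C)

-- Every vertex of S ∪ N⁻(S) is one arc away from S in both directions
-- (into S by definition, out of S since D is source-free and in-neighbours
-- of N⁻(S) lie in S), so it suffices to bound distances inside S by
-- 2(|S| − 1). Fix x ∈ S and let Lₖ be the vertices of S within distance 2k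
-- of x. If Lₖ₊₁ = Lₖ then Lₖ is a pseudo-source set, hence Lₖ = S by
-- properness; so Lₖ grows strictly until it is S, which happens by
-- k = |S| − 1. Maximality: a walk ending in a pseudo-source set S cannot
-- leave S ∪ N⁻(S) when traced backwards.
module Submission where

open import Defs
open import Level using (Level; 0ℓ)
open import Data.Nat using (ℕ; zero; suc; _*_; _+_; _≤_; _<_; z≤n; s≤s)
open import Data.Nat.Properties using (≤-trans; ≤-reflexive; +-mono-≤; +-comm; *-suc; <⇒≱; <-≤-trans; n≤1+n)
open import Data.Fin using (Fin)
open import Data.Fin.Subset using (Subset; Nonempty; ∣_∣; _∈_; _⊆_; _⊈_; _∩_; ⁅_⁆)
open import Data.Fin.Subset.Properties
  using (_∈?_; _⊆?_; x∈p∩q⁺; x∈p∩q⁻; p∩q⊆p; x∈⁅y⁆⇒x≡y; x∈⁅x⁆; ∣⁅x⁆∣≡1; p⊆q⇒∣p∣≤∣q∣; p⊂q⇒∣p∣<∣q∣)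
open import Data.Fin.Properties using (any?; ¬∀⟶∃¬)
open import Data.Vec using (tabulate)
open import Data.Vec.Properties using (lookup∘tabulate; []=⇒lookup; lookup⇒[]=)
open import Data.Product using (∃-syntax; _×_; _,_; proj₁; proj₂)
open import Data.Sum using (_⊎_; inj₁; inj₂)
open import Data.Bool using (T)
open import Function using (_∘_)
open import Relation.Nullary using (¬_; yes; no; does; contradiction)
open import Relation.Nullary.Decidable using (T?; dec-true; _×-dec_; _⊎-dec_; _→-dec_)
open import Relation.Unary using (Pred; Decidable)
open import Relation.Binary.PropositionalEquality using (_≡_; refl; sym; trans; subst; cong; module ≡-Reasoning)

private
  variable
    ℓ : Level
    n : ℕ

p⊆q⇒q⊈p⇒∣p∣<∣q∣ : {p q : Subset n} → p ⊆ q → q ⊈ p → ∣ p ∣ < ∣ q ∣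
p⊆q⇒q⊈p⇒∣p∣<∣q∣ {n} {p} {q} p⊆q q⊈p
  with ¬∀⟶∃¬ n (λ i → i ∈ q → i ∈ p) (λ i → i ∈? q →-dec i ∈? p) (λ q⊆p → q⊈p (q⊆p _))
... | i , ¬[i∈q⇒i∈p] with i ∈? q
...   | yes i∈q = p⊂q⇒∣p∣<∣q∣ (p⊆q , i , i∈q , λ i∈p → ¬[i∈q⇒i∈p] (λ _ → i∈p))
...   | no  i∉q = contradiction (λ i∈q → contradiction i∈q i∉q) ¬[i∈q⇒i∈p]

nonempty⇒∣p∣>0 : {p : Subset n} → Nonempty p → 0 < ∣ p ∣
nonempty⇒∣p∣>0 {p = p} (x , x∈p) =
  ≤-trans (≤-reflexive (sym (∣⁅x⁆∣≡1 x))) (p⊆q⇒∣p∣≤∣q∣ ⁅x⁆⊆p)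
  where
  ⁅x⁆⊆p : ⁅ x ⁆ ⊆ p
  ⁅x⁆⊆p y∈⁅x⁆ = subst (_∈ p) (sym (x∈⁅y⁆⇒x≡y x y∈⁅x⁆)) x∈p

nonempty⇒∣p∣≡suc : {p : Subset n} → Nonempty p → ∃[ m ] ∣ p ∣ ≡ suc m
nonempty⇒∣p∣≡suc {p = p} ne with ∣ p ∣ | nonempty⇒∣p∣>0 ne
... | suc m | _ = m , refl

subsetOf : {P : Pred (Fin n) ℓ} → Decidable P → Subset n
subsetOf P? = tabulate (does ∘ P?)

module _ {P : Pred (Fin n) ℓ} (P? : Decidable P) where

  ∈-subsetOf⁺ : ∀ {x} → P x → x ∈ subsetOf P?
  ∈-subsetOf⁺ {x} px = lookup⇒[]= x _ (trans (lookup∘tabulate _ x) (dec-true (P? x) px))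

  ∈-subsetOf⁻ : ∀ {x} → x ∈ subsetOf P? → P x
  ∈-subsetOf⁻ {x} x∈ with P? x | trans (sym (lookup∘tabulate (does ∘ P?) x)) ([]=⇒lookup x∈)
  ... | yes px | _ = px
  ... | no  _  | ()

module Saturation {S : Subset n} (L : ℕ → Subset n)
  (L⊆S : ∀ k → L k ⊆ S) (L-mono : ∀ k → L k ⊆ L (suc k))
  (stalled⇒full : ∀ k → L (suc k) ⊆ L k → S ⊆ L k) (L₀-nonempty : Nonempty (L 0)) where

  full-or-large : ∀ k → S ⊆ L k ⊎ suc k ≤ ∣ L k ∣
  full-or-large zero = inj₂ (nonempty⇒∣p∣>0 L₀-nonempty)
  full-or-large (suc k) with full-or-large k | L (suc k) ⊆? L k
  ... | inj₁ S⊆Lk   | _         = inj₁ (L-mono k ∘ S⊆Lk)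
  ... | inj₂ _      | yes stall = inj₁ (L-mono k ∘ stalled⇒full k stall)
  ... | inj₂ k<∣L∣ | no  grow  = inj₂ (<-≤-trans (s≤s k<∣L∣) (p⊆q⇒q⊈p⇒∣p∣<∣q∣ (L-mono k) grow))

  saturated : ∀ {m} → ∣ S ∣ ≡ suc m → S ⊆ L m
  saturated {m} ∣S∣≡1+m with full-or-large m | S ⊆? L m
  ... | inj₁ S⊆Lm  | _        = S⊆Lm
  ... | inj₂ _     | yes S⊆Lm = S⊆Lm
  ... | inj₂ m<∣L∣ | no  S⊈Lm =
    contradiction m<∣L∣ (<⇒≱ (subst (∣ L m ∣ <_) ∣S∣≡1+m (p⊆q⇒q⊈p⇒∣p∣<∣q∣ (L⊆S m) S⊈Lm)))

module _ (D : Digraph n) where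

  _++ʷ_ : ∀ {a b c i j} → Walk D a b i → Walk D b c j → Walk D a c (i + j)
  here       ++ʷ q = q
  step e p   ++ʷ q = step e (p ++ʷ q)

  distLe-trans : ∀ {a b c i j} → DistLe D a b i → DistLe D b c j → DistLe D a c (i + j)
  distLe-trans (l , l≤i , p) (m , m≤j , q) = l + m , +-mono-≤ l≤i m≤j , p ++ʷ q

  distLe-mono : ∀ {a b i j} → i ≤ j → DistLe D a b i → DistLe D a b j
  distLe-mono i≤j (l , l≤i , p) = l , ≤-trans l≤i i≤j , p

  arc⇒distLe1 : ∀ {u v} → Arc D u v → DistLe D u v 1
  arc⇒distLe1 a = 1 , s≤s z≤n , step a here

  distLe0 : ∀ {v} → DistLe D v v 0
  distLe0 = 0 , z≤n , here

  diameterLe⇒stronglyConnected : ∀ {C k} → DiameterLe D C k → StronglyConnected D C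
  diameterLe⇒stronglyConnected diam u v u∈C v∈C with diam u v u∈C v∈C
  ... | l , _ , w = l , w

  arc⇒≢ : ∀ {u v} → Arc D u v → ¬ u ≡ v
  arc⇒≢ {u} a refl = subst T (noLoop D u) a

  StepsInto : Subset n → Pred (Fin n) 0ℓ
  StepsInto P y = y ∈ P ⊎ ∃[ w ] (Arc D y w × w ∈ P)

  stepsInto? : ∀ P → Decidable (StepsInto P)
  stepsInto? P y = y ∈? P ⊎-dec any? (λ w → T? (adj D y w) ×-dec w ∈? P)

  -- The vertices within distance j of x, distance being measured towards x.
  ball : Fin n → ℕ → Subset n
  ball x zero    = ⁅ x ⁆
  ball x (suc j) = subsetOf (stepsInto? (ball x j))

  ball-centre : ∀ x j → x ∈ ball x j
  ball-centre x zero    = x∈⁅x⁆ x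
  ball-centre x (suc j) = ∈-subsetOf⁺ (stepsInto? _) (inj₁ (ball-centre x j))

  ball-mono : ∀ x j → ball x j ⊆ ball x (suc j)
  ball-mono x j y∈ = ∈-subsetOf⁺ (stepsInto? _) (inj₁ y∈)

  ball-arc : ∀ x j {y w} → Arc D y w → w ∈ ball x j → y ∈ ball x (suc j)
  ball-arc x j a w∈ = ∈-subsetOf⁺ (stepsInto? _) (inj₂ (_ , a , w∈))

  ball⇒distLe : ∀ x j {y} → y ∈ ball x j → DistLe D y x j
  ball⇒distLe x zero    y∈ rewrite x∈⁅y⁆⇒x≡y x y∈ = distLe0
  ball⇒distLe x (suc j) y∈ with ∈-subsetOf⁻ (stepsInto? (ball x j)) y∈
  ... | inj₁ y∈′          = distLe-mono (n≤1+n j) (ball⇒distLe x j y∈′)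
  ... | inj₂ (w , a , w∈) = distLe-trans (arc⇒distLe1 a) (ball⇒distLe x j w∈)

  InClosedNbhd : Subset n → Fin n → Set
  InClosedNbhd S x = x ∈ S ⊎ InNeighbour D S x

  module _ {S : Subset n} (ps : PseudoSource D S) where

    private
      inNeighbour-closed : ∀ v → InNeighbour D S v → ∀ u → ¬ u ≡ v → Arc D u v → u ∈ S
      inNeighbour-closed = proj₂ ps

    walk⇒inClosedNbhd : ∀ {y x l} → Walk D y x l → x ∈ S → InClosedNbhd S y
    walk⇒inClosedNbhd here x∈S = inj₁ x∈S
    walk⇒inClosedNbhd {y} (step {w = w} a p) x∈S with walk⇒inClosedNbhd p x∈S | y ∈? S
    ... | inj₂ w∈N | _       = inj₁ (inNeighbour-closed w w∈N y (arc⇒≢ a) a)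
    ... | inj₁ _   | yes y∈S = inj₁ y∈S
    ... | inj₁ w∈S | no  y∉S = inj₂ (y∉S , w , w∈S , a)

    inClosedNbhd⇒distLe-to-S : ∀ {u} → InClosedNbhd S u → ∃[ s ] (s ∈ S × DistLe D u s 1)
    inClosedNbhd⇒distLe-to-S (inj₁ u∈S)              = _ , u∈S , distLe-mono z≤n distLe0
    inClosedNbhd⇒distLe-to-S (inj₂ (_ , s , s∈S , a)) = s , s∈S , arc⇒distLe1 a

    inClosedNbhd⇒distLe-from-S : SourceFree D → ∀ {v} → InClosedNbhd S v → ∃[ s ] (s ∈ S × DistLe D s v 1)
    inClosedNbhd⇒distLe-from-S _  (inj₁ v∈S) = _ , v∈S , distLe-mono z≤n distLe0
    inClosedNbhd⇒distLe-from-S sf {v} (inj₂ v∈N) with sf v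
    ... | w , a = w , inNeighbour-closed v v∈N w (arc⇒≢ a) a , arc⇒distLe1 a

    closedNbhd-maximal : ∀ {C} → IsClosedNbhd D S C →
                         ∀ C′ → C ⊆ C′ → StronglyConnected D C′ → C′ ⊆ C
    closedNbhd-maximal {C} cl C′ C⊆C′ sc {y} y∈C′ with proj₁ ps
    ... | s , s∈S with sc y s y∈C′ (C⊆C′ (proj₂ (cl s) (inj₁ s∈S)))
    ...   | _ , w = proj₂ (cl y) (walk⇒inClosedNbhd w s∈S)

    -- The ball grows by two steps: one to catch an in-neighbour v of the
    -- layer, one more to catch the in-neighbours of v.
    stalled⇒pseudoSource : ∀ {x} j → x ∈ S → S ∩ ball x (2 + j) ⊆ S ∩ ball x j →
                           PseudoSource D (S ∩ ball x j)
    stalled⇒pseudoSource {x} j x∈S stall = (x , x∈p∩q⁺ (x∈S , ball-centre x j)) , closed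
      where
      closed : ∀ v → InNeighbour D (S ∩ ball x j) v → ∀ u → ¬ u ≡ v → Arc D u v → u ∈ S ∩ ball x j
      closed v (v∉L , t , t∈L , vt) u u≢v uv with x∈p∩q⁻ S (ball x j) t∈L | v ∈? S
      ... | t∈S , t∈B | yes v∈S =
        contradiction (stall (x∈p∩q⁺ (v∈S , ball-mono x (suc j) (ball-arc x j vt t∈B)))) v∉L
      ... | t∈S , t∈B | no  v∉S =
        stall (x∈p∩q⁺ (inNeighbour-closed v (v∉S , t , t∈S , vt) u u≢v uv ,
                       ball-arc x (suc j) uv (ball-arc x j vt t∈B)))

  properPseudoSource-minimal : ∀ {S T′} → ProperPseudoSource D S →
                               T′ ⊆ S → PseudoSource D T′ → S ⊆ T′
  properPseudoSource-minimal {S} {T′} (_ , proper) T′⊆S ps with S ⊆? T′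
  ... | yes S⊆T′ = S⊆T′
  ... | no  S⊈T′ = contradiction ps (proper T′ (proj₁ ps) T′⊆S S⊈T′)

  module _ {S : Subset n} (pps : ProperPseudoSource D S) where

    private
      ps : PseudoSource D S
      ps = proj₁ pps

    -- The layers S ∩ ball x (2k) can only stop growing at a pseudo-source
    -- subset of S, which by minimality is S itself.
    properPseudoSource-distLe : ∀ {m} → ∣ S ∣ ≡ suc m →
                                ∀ {x y} → x ∈ S → y ∈ S → DistLe D y x (2 * m)
    properPseudoSource-distLe {m} ∣S∣≡1+m {x} x∈S y∈S =
      ball⇒distLe x (2 * m) (proj₂ (x∈p∩q⁻ S _ (saturated ∣S∣≡1+m y∈S)))
      where
      layer : ℕ → Subset n
      layer k = S ∩ ball x (2 * k)

      layer-suc : ∀ k → layer (suc k) ≡ S ∩ ball x (2 + 2 * k)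
      layer-suc k = cong (λ j → S ∩ ball x j) (*-suc 2 k)

      layer-mono : ∀ k → layer k ⊆ layer (suc k)
      layer-mono k {z} z∈L with x∈p∩q⁻ S _ z∈L
      ... | z∈S , z∈B =
        subst (z ∈_) (sym (layer-suc k))
              (x∈p∩q⁺ (z∈S , ball-mono x (suc (2 * k)) (ball-mono x (2 * k) z∈B)))

      stalled⇒full : ∀ k → layer (suc k) ⊆ layer k → S ⊆ layer k
      stalled⇒full k stall =
        properPseudoSource-minimal pps (p∩q⊆p S _)
          (stalled⇒pseudoSource ps (2 * k) x∈S (λ {z} z∈ → stall (subst (z ∈_) (sym (layer-suc k)) z∈)))

      open Saturation layer (λ k → p∩q⊆p S _) layer-mono stalled⇒full
                      (x , x∈p∩q⁺ (x∈S , ball-centre x 0))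

    closedNbhd-diameterLe : SourceFree D → ∀ {C} → IsClosedNbhd D S C → DiameterLe D C (2 * ∣ S ∣)
    closedNbhd-diameterLe sf cl u v u∈C v∈C
      with nonempty⇒∣p∣≡suc (proj₁ ps)
         | inClosedNbhd⇒distLe-to-S ps (proj₁ (cl u) u∈C)
         | inClosedNbhd⇒distLe-from-S ps sf (proj₁ (cl v) v∈C)
    ... | m , ∣S∣≡1+m | s , s∈S , us | s′ , s′∈S , s′v =
      distLe-mono (≤-reflexive length≡)
        (distLe-trans (distLe-trans us (properPseudoSource-distLe ∣S∣≡1+m s′∈S s∈S)) s′v)
      where
      open ≡-Reasoning
      length≡ : 1 + 2 * m + 1 ≡ 2 * ∣ S ∣
      length≡ = begin
        1 + 2 * m + 1  ≡⟨ +-comm (1 + 2 * m) 1 ⟩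
        2 + 2 * m      ≡⟨ *-suc 2 m ⟨
        2 * suc m      ≡⟨ cong (2 *_) ∣S∣≡1+m ⟨
        2 * ∣ S ∣      ∎

lemma5p8 : ∀ {n} (D : Digraph n) → SourceFree D →
    ∀ (S : Subset n) → ProperPseudoSource D S →
    ∀ (C : Subset n) → IsClosedNbhd D S C →
    SCC D C × DiameterLe D C (2 * ∣ S ∣)
lemma5p8 D sf S pps C cl =
  (diameterLe⇒stronglyConnected D diam , closedNbhd-maximal D (proj₁ pps) cl) , diam
  where
  diam : DiameterLe D C (2 * ∣ S ∣)
  diam = closedNbhd-diameterLe D pps sf cl
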